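{- Let $y\ge 0$ be an integer and let $n>2y$ be an odd integer. Consider the set of all $n$-words $w$ over the alphabet $\{0,1,2\}$ (ordered $0<1<2$) that contain exactly $2y$ occurrences of the letter $1$ and in which the number $x$ of occurrences of $0$ is larger than the number $z$ of occurrences of $2$. Let $w$ be a word in this set minimizing $m(3,w)$ over the set, and let $u$ be the subword of $w$ obtained by deleting all occurrences of $1$. Then $u$ is alternating, i.e., any two consecutive letters of $u$ are distinct.
   Context: An $n$-word is a sequence $w=(w_1,\ldots,w_n)$ of letters. A subword is a subsequence $w_{i_1}\cdots w_{i_k}$ with $i_1<\cdots<i_k$ (counted by position sets); it is monotone if it is non-decreasing or non-increasing. $m(3,w)$ denotes the number of monotone $3$-subwords of $w$. -}

module Defs where

open import Data.Nat using (ℕ; zero; suc; _+_; _≤_; _<_)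
open import Data.Fin using (Fin)
open import Data.List using (List; []; _∷_; length; filter)
open import Data.Product using (_×_; ∃)
open import Data.Sum using (_⊎_)
open import Relation.Nullary using (¬_)
open import Relation.Nullary.Decidable using (yes; no)
open import Data.Fin.Properties using (_≟_; _≤?_)
open import Relation.Binary.PropositionalEquality using (_≡_)

Letter : Set
Letter = Fin 3

occ : Letter → List Letter → ℕ
occ a [] = 0
occ a (b ∷ w) with a ≟ b
... | yes _ = suc (occ a w)
... | no _ = occ a w

mono? : Letter → Letter → Letter → ℕ
mono? a b c with _≤?_ a b | _≤?_ b c | _≤?_ b a | _≤?_ c b
... | yes _ | yes _ | _ | _ = 1
... | _ | _ | yes _ | yes _ = 1
... | _ | _ | _ | _ = 0

m2after : Letter → List Letter → ℕ
m2after a [] = 0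
m2after a (b ∷ w) = go b w + m2after a w
  where
  go : Letter → List Letter → ℕ
  go b [] = 0
  go b (c ∷ v) = mono? a b c + go b v

-- m(3,w): number of position triples i<j<k with w_i w_j w_k monotone
m3 : List Letter → ℕ
m3 [] = 0
m3 (a ∷ w) = m2after a w + m3 w

InSet : ℕ → ℕ → List Letter → Set
InSet n y w = (length w ≡ n) × (occ (Fin.suc Fin.zero) w ≡ y + y)
            × (occ (Fin.suc (Fin.suc Fin.zero)) w < occ Fin.zero w)
  where import Data.Fin as Fin

delete1 : List Letter → List Letter
delete1 [] = []
delete1 (a ∷ w) with a ≟ Data.Fin.suc Data.Fin.zero
... | yes _ = delete1 w
... | no _ = a ∷ delete1 w

data Alternating : List Letter → Set where
  alt[]  : Alternating []
  alt[_] : (a : Letter) → Alternating (a ∷ [])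
  alt∷   : ∀ {a b w} → ¬ (a ≡ b) → Alternating (b ∷ w) → Alternating (a ∷ b ∷ w)

Odd : ℕ → Set
Odd n = ∃ λ k → n ≡ suc (k + k)

module Submission where

-- Give the letters 0, 1, 2 the signs σ = 1, 0, −1 and the weights μ = 1, 2, 1, and let S be the σ-sum
-- of w. The walk that starts at −S and moves by 2σ at each letter takes, just after the j-th letter,
-- the value r_j = (σ-sum of w_1 ⋯ w_j) − (σ-sum of w_{j+1} ⋯ w_n), and
--   8 m(3, w) = Σ_j μ_j r_j² + C,
-- where C depends only on the positions of the letters 1. When n is odd and the number of 1s is even,
-- S and all r_j are odd, so Σ_j μ_j r_j² ≥ Σ_j μ_j. Equality holds for the word with the same 1s whose
-- other letters alternate 0 2 0 ⋯ 0; it has one more 0 than 2s, so it lies in the set. If u is not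
-- alternating, a factor a 1 ⋯ 1 a with a ≠ 1 makes the walk take two equal steps in a row, and one of
-- the three values involved has square ≥ 9. That value may be the start −S, which is not counted, but
-- its square is that of the final value S, which is; either way Σ_j μ_j r_j² > Σ_j μ_j. Hence the
-- alternating word has fewer monotone 3-subwords than w.

open import Defs
open import Data.Nat as ℕ using (ℕ; suc)
import Data.Nat.Properties as ℕ
open import Data.List using (List; []; _∷_; map; length)
open import Data.Bool using (Bool; true; false)
open import Data.Fin using (zero; suc)
open import Data.Sum as Sum using (_⊎_; inj₁; inj₂)
open import Data.Empty using (⊥; ⊥-elim)
open import Data.List.Relation.Unary.Any using (Any; here; there)
open import Relation.Binary.PropositionalEquality using (_≡_; refl; sym; trans; cong)
open import Data.List.Properties using (length-map)

pattern L0 = zero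
pattern L1 = suc zero
pattern L2 = suc (suc zero)

data Outer : Letter → Set where
  outer₀ : Outer L0
  outer₂ : Outer L2

data LeadsWith (a : Letter) : List Letter → Set where
  skip : ∀ {v} → LeadsWith a v → LeadsWith a (L1 ∷ v)
  hit  : ∀ {v} → LeadsWith a (a ∷ v)

-- w has a factor a 1 ⋯ 1 a with a ≠ 1, i.e. delete1 w has two equal neighbours
data Repeats : List Letter → Set where
  here  : ∀ {a v} → Outer a → LeadsWith a v → Repeats (a ∷ v)
  there : ∀ {b v} → Repeats v → Repeats (b ∷ v)

repeats-outer : ∀ {v} → Repeats v → Any Outer v
repeats-outer (here oa _) = here oa
repeats-outer (there p)   = there (repeats-outer p)

repeats-skip : ∀ {a v} → Repeats (a ∷ v) → Repeats (a ∷ L1 ∷ v)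
repeats-skip (here oa p) = here oa (skip p)
repeats-skip (there r)   = there (there r)

alternating⊎repeats-from : ∀ {a} → Outer a → ∀ v → Alternating (a ∷ delete1 v) ⊎ Repeats (a ∷ v)
alternating⊎repeats-from {a} _ [] = inj₁ alt[ a ]
alternating⊎repeats-from oa (L1 ∷ v) = Sum.map₂ repeats-skip (alternating⊎repeats-from oa v)
alternating⊎repeats-from outer₀ (L0 ∷ v) = inj₂ (here outer₀ hit)
alternating⊎repeats-from outer₀ (L2 ∷ v) = Sum.map (alt∷ λ ()) there (alternating⊎repeats-from outer₂ v)
alternating⊎repeats-from outer₂ (L0 ∷ v) = Sum.map (alt∷ λ ()) there (alternating⊎repeats-from outer₀ v)
alternating⊎repeats-from outer₂ (L2 ∷ v) = inj₂ (here outer₂ hit)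

alternating⊎repeats : ∀ w → Alternating (delete1 w) ⊎ Repeats w
alternating⊎repeats [] = inj₁ alt[]
alternating⊎repeats (L0 ∷ v) = alternating⊎repeats-from outer₀ v
alternating⊎repeats (L1 ∷ v) = Sum.map₂ there (alternating⊎repeats v)
alternating⊎repeats (L2 ∷ v) = alternating⊎repeats-from outer₂ v

isOne : Letter → Bool
isOne L0 = false
isOne L1 = true
isOne L2 = false

onesMask : List Letter → List Bool
onesMask = map isOne

alternate : Bool → List Letter → List Letter
alternate b     []       = []
alternate b     (L1 ∷ v) = L1 ∷ alternate b v
alternate true  (L0 ∷ v) = L0 ∷ alternate false v
alternate true  (L2 ∷ v) = L0 ∷ alternate false v
alternate false (L0 ∷ v) = L2 ∷ alternate true v
alternate false (L2 ∷ v) = L2 ∷ alternate true v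

onesMask-alternate : ∀ b v → onesMask (alternate b v) ≡ onesMask v
onesMask-alternate b     []       = refl
onesMask-alternate b     (L1 ∷ v) = cong (true ∷_) (onesMask-alternate b v)
onesMask-alternate true  (L0 ∷ v) = cong (false ∷_) (onesMask-alternate false v)
onesMask-alternate true  (L2 ∷ v) = cong (false ∷_) (onesMask-alternate false v)
onesMask-alternate false (L0 ∷ v) = cong (false ∷_) (onesMask-alternate true v)
onesMask-alternate false (L2 ∷ v) = cong (false ∷_) (onesMask-alternate true v)

length-alternate : ∀ b v → length (alternate b v) ≡ length v
length-alternate b v =
  trans (sym (length-map isOne (alternate b v))) (trans (cong length (onesMask-alternate b v)) (length-map isOne v))

module Potential where

  open import Data.Integer using (ℤ; 0ℤ; -1ℤ; +_; -[1+_]; _+_; _-_; _*_; -_; _≤_; _<_; +≤+)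
  open import Data.Integer.Properties as ℤ using (module ≤-Reasoning)
  open import Data.Integer.Tactic.RingSolver using (solve-∀; solve)
  open import Algebra.Properties.CommutativeSemigroup ℤ.+-commutativeSemigroup using (xy∙z≈xz∙y; x∙yz≈y∙xz; x∙yz≈xz∙y)
  open import Data.Product using (Σ; _,_)
  open import Relation.Binary.PropositionalEquality using (cong₂; module ≡-Reasoning)

  +-cancelʳ-≤ : ∀ {i j} k → i + k ≤ j + k → i ≤ j
  +-cancelʳ-≤ {i} {j} k le = begin
    i              ≡⟨ cancel i k ⟨
    i + k - k      ≤⟨ ℤ.+-monoˡ-≤ (- k) le ⟩
    j + k - k      ≡⟨ cancel j k ⟩
    j              ∎
    where
    open ≤-Reasoning
    cancel : ∀ i k → i + k - k ≡ i
    cancel = solve-∀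

  -- The walk of a word

  sq : ℤ → ℤ
  sq r = r * r

  count : Letter → List Letter → ℤ
  count a w = + occ a w

  balance : List Letter → ℤ
  balance w = count L0 w - count L2 w

  μ : Letter → ℤ
  μ L0 = + 1
  μ L1 = + 2
  μ L2 = + 1

  weight : List Letter → ℤ
  weight []      = 0ℤ
  weight (a ∷ w) = μ a + weight w

  next : Letter → ℤ → ℤ
  next L0 r = r + + 2
  next L1 r = r
  next L2 r = r - + 2

  walkSum walkSq : ℤ → List Letter → ℤ
  walkSum r []      = 0ℤ
  walkSum r (a ∷ v) = μ a * next a r + walkSum (next a r) v
  walkSq r []      = 0ℤ
  walkSq r (a ∷ v) = μ a * sq (next a r) + walkSq (next a r) v

  walkEnd : ℤ → List Letter → ℤ
  walkEnd r []      = r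
  walkEnd r (a ∷ v) = walkEnd (next a r) v

  Φ : List Letter → ℤ
  Φ w = walkSq (- balance w) w

  balance-L0 : ∀ v → balance (L0 ∷ v) ≡ + 1 + balance v
  balance-L0 v = ℤ.+-assoc (+ 1) (count L0 v) (- count L2 v)

  balance-L2 : ∀ v → balance (L2 ∷ v) ≡ -1ℤ + balance v
  balance-L2 v = shift (count L0 v) (count L2 v)
    where
    shift : ∀ x z → x - (+ 1 + z) ≡ -1ℤ + (x - z)
    shift = solve-∀

  weight-counts : ∀ v → weight v ≡ count L0 v + count L2 v + + 2 * count L1 v
  weight-counts [] = refl
  weight-counts (L0 ∷ v) = trans (cong (λ t → + 1 + t) (weight-counts v)) (step (count L0 v) (count L1 v) (count L2 v))
    where
    step : ∀ x y z → + 1 + (x + z + + 2 * y) ≡ + 1 + x + z + + 2 * y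
    step = solve-∀
  weight-counts (L1 ∷ v) = trans (cong (λ t → + 2 + t) (weight-counts v)) (step (count L0 v) (count L1 v) (count L2 v))
    where
    step : ∀ x y z → + 2 + (x + z + + 2 * y) ≡ x + z + + 2 * (+ 1 + y)
    step = solve-∀
  weight-counts (L2 ∷ v) = trans (cong (λ t → + 1 + t) (weight-counts v)) (step (count L0 v) (count L1 v) (count L2 v))
    where
    step : ∀ x y z → + 1 + (x + z + + 2 * y) ≡ x + (+ 1 + z) + + 2 * y
    step = solve-∀

  length-counts : ∀ v → + length v ≡ count L0 v + count L1 v + count L2 v
  length-counts [] = refl
  length-counts (L0 ∷ v) = trans (cong (λ t → + 1 + t) (length-counts v)) (step (count L0 v) (count L1 v) (count L2 v))
    where
    step : ∀ x y z → + 1 + (x + y + z) ≡ + 1 + x + y + z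
    step = solve-∀
  length-counts (L1 ∷ v) = trans (cong (λ t → + 1 + t) (length-counts v)) (step (count L0 v) (count L1 v) (count L2 v))
    where
    step : ∀ x y z → + 1 + (x + y + z) ≡ x + (+ 1 + y) + z
    step = solve-∀
  length-counts (L2 ∷ v) = trans (cong (λ t → + 1 + t) (length-counts v)) (step (count L0 v) (count L1 v) (count L2 v))
    where
    step : ∀ x y z → + 1 + (x + y + z) ≡ x + y + (+ 1 + z)
    step = solve-∀

  ones others : List Bool → ℤ
  ones []          = 0ℤ
  ones (true ∷ m)  = + 1 + ones m
  ones (false ∷ m) = ones m
  others []          = 0ℤ
  others (true ∷ m)  = others m
  others (false ∷ m) = + 1 + others m

  ones-mask : ∀ v → ones (onesMask v) ≡ count L1 v
  ones-mask []       = refl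
  ones-mask (L0 ∷ v) = ones-mask v
  ones-mask (L1 ∷ v) = cong (λ t → + 1 + t) (ones-mask v)
  ones-mask (L2 ∷ v) = ones-mask v

  others-mask : ∀ v → others (onesMask v) ≡ count L0 v + count L2 v
  others-mask []       = refl
  others-mask (L0 ∷ v) = trans (cong (λ t → + 1 + t) (others-mask v)) (sym (ℤ.+-assoc (+ 1) (count L0 v) (count L2 v)))
  others-mask (L1 ∷ v) = others-mask v
  others-mask (L2 ∷ v) = trans (cong (λ t → + 1 + t) (others-mask v)) (x∙yz≈y∙xz (+ 1) (count L0 v) (count L2 v))

  next-+ : ∀ a r d → next a (r + d) ≡ next a r + d
  next-+ L0 r d = xy∙z≈xz∙y r d (+ 2)
  next-+ L1 r d = refl
  next-+ L2 r d = xy∙z≈xz∙y r d (- + 2)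

  walkSum-+ : ∀ r d v → walkSum (r + d) v ≡ walkSum r v + d * weight v
  walkSum-+ r d [] = sym (trans (ℤ.+-identityˡ (d * 0ℤ)) (ℤ.*-zeroʳ d))
  walkSum-+ r d (a ∷ v) rewrite next-+ a r d | walkSum-+ (next a r) d v =
    expand (μ a) (next a r) d (walkSum (next a r) v) (weight v)
    where
    expand : ∀ m x d L W → m * (x + d) + (L + d * W) ≡ (m * x + L) + d * (m + W)
    expand = solve-∀

  walkSq-+ : ∀ r d v → walkSq (r + d) v ≡ walkSq r v + + 2 * d * walkSum r v + d * d * weight v
  walkSq-+ r d [] = vanish d
    where
    vanish : ∀ d → 0ℤ ≡ 0ℤ + + 2 * d * 0ℤ + d * d * 0ℤ
    vanish = solve-∀
  walkSq-+ r d (a ∷ v) rewrite next-+ a r d | walkSq-+ (next a r) d v =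
    expand (μ a) (next a r) d (walkSq (next a r) v) (walkSum (next a r) v) (weight v)
    where
    expand : ∀ m x d P L W → m * ((x + d) * (x + d)) + (P + + 2 * d * L + d * d * W)
                           ≡ (m * (x * x) + P) + + 2 * d * (m * x + L) + d * d * (m + W)
    expand = solve-∀

  walkSum-+′ : ∀ {r′} r d v → r′ ≡ r + d → walkSum r′ v ≡ walkSum r v + d * weight v
  walkSum-+′ r d v refl = walkSum-+ r d v

  walkSq-+′ : ∀ {r′} r d v → r′ ≡ r + d → walkSq r′ v ≡ walkSq r v + + 2 * d * walkSum r v + d * d * weight v
  walkSq-+′ r d v refl = walkSq-+ r d v

  restart₀ : ∀ v → next L0 (- balance (L0 ∷ v)) ≡ - balance v + + 1
  restart₀ v = shift (count L0 v) (count L2 v)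
    where
    shift : ∀ x z → - (+ 1 + x - z) + + 2 ≡ - (x - z) + + 1
    shift = solve-∀

  restart₂ : ∀ v → next L2 (- balance (L2 ∷ v)) ≡ - balance v + -1ℤ
  restart₂ v = shift (count L0 v) (count L2 v)
    where
    shift : ∀ x z → - (x - (+ 1 + z)) - + 2 ≡ - (x - z) + -1ℤ
    shift = solve-∀

  next-balance : ∀ a r v → next a r + + 2 * balance v ≡ r + + 2 * balance (a ∷ v)
  next-balance L0 r v = shift (count L0 v) (count L2 v)
    where
    shift : ∀ x z → r + + 2 + + 2 * (x - z) ≡ r + + 2 * (+ 1 + x - z)
    shift x z = solve (r ∷ x ∷ z ∷ [])
  next-balance L1 r v = refl
  next-balance L2 r v = shift (count L0 v) (count L2 v)
    where
    shift : ∀ x z → r - + 2 + + 2 * (x - z) ≡ r + + 2 * (x - (+ 1 + z))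
    shift x z = solve (r ∷ x ∷ z ∷ [])

  walkEnd≡ : ∀ r v → walkEnd r v ≡ r + + 2 * balance v
  walkEnd≡ r []      = sym (ℤ.+-identityʳ r)
  walkEnd≡ r (a ∷ v) = trans (walkEnd≡ (next a r) v) (next-balance a r v)

  sq-walkEnd : ∀ v → sq (walkEnd (- balance v) v) ≡ sq (- balance v)
  sq-walkEnd v = trans (cong sq (walkEnd≡ (- balance v) v)) (reflect (balance v))
    where
    reflect : ∀ B → (- B + + 2 * B) * (- B + + 2 * B) ≡ (- B) * (- B)
    reflect = solve-∀

  -- m(3, w) in terms of the walk

  corr₀ corr₁ corr : List Bool → ℤ
  corr₀ []          = -1ℤ
  corr₀ (true ∷ m)  = corr₀ m + (+ 8 * ones m + + 4 * others m - + 2)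
  corr₀ (false ∷ m) = corr₀ m + (+ 6 * others m + + 4 * ones m - + 2)
  corr₁ []          = 0ℤ
  corr₁ (true ∷ m)  = corr₁ m + + 8 * (others m + ones m)
  corr₁ (false ∷ m) = corr₁ m + (+ 4 * others m - + 2)
  corr []          = 0ℤ
  corr (true ∷ m)  = corr m + corr₁ m
  corr (false ∷ m) = corr m + corr₀ m

  pairs : Letter → Letter → List Letter → ℕ
  pairs a b []      = 0
  pairs a b (c ∷ v) = mono? a b c ℕ.+ pairs a b v

  -- The inner sum of m2after is local to Defs; it is identified with pairs by cancelling m2after a v.
  m2after-∷ : ∀ a b v → m2after a (b ∷ v) ≡ pairs a b v ℕ.+ m2after a v
  m2after-∷ a b []      = refl
  m2after-∷ a b (c ∷ v) =
    cong (λ t → mono? a b c ℕ.+ t ℕ.+ m2after a (c ∷ v)) (ℕ.+-cancelʳ-≡ (m2after a v) _ _ (m2after-∷ a b v))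

  pairsℤ : Letter → Letter → List Letter → ℤ
  pairsℤ a b v = + mono? a b L0 * count L0 v + + mono? a b L1 * count L1 v + + mono? a b L2 * count L2 v

  pairs-counts : ∀ a b v → + pairs a b v ≡ pairsℤ a b v
  pairs-counts a b [] = vanish (+ mono? a b L0) (+ mono? a b L1) (+ mono? a b L2)
    where
    vanish : ∀ p q s → 0ℤ ≡ p * 0ℤ + q * 0ℤ + s * 0ℤ
    vanish = solve-∀
  pairs-counts a b (L0 ∷ v) =
    trans (cong (λ t → + mono? a b L0 + t) (pairs-counts a b v)) (step (+ mono? a b L0) (+ mono? a b L1) (+ mono? a b L2) (count L0 v) (count L1 v) (count L2 v))
    where
    step : ∀ p q s x y z → p + (p * x + q * y + s * z) ≡ p * (+ 1 + x) + q * y + s * z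
    step = solve-∀
  pairs-counts a b (L1 ∷ v) =
    trans (cong (λ t → + mono? a b L1 + t) (pairs-counts a b v)) (step (+ mono? a b L0) (+ mono? a b L1) (+ mono? a b L2) (count L0 v) (count L1 v) (count L2 v))
    where
    step : ∀ p q s x y z → q + (p * x + q * y + s * z) ≡ p * x + q * (+ 1 + y) + s * z
    step = solve-∀
  pairs-counts a b (L2 ∷ v) =
    trans (cong (λ t → + mono? a b L2 + t) (pairs-counts a b v)) (step (+ mono? a b L0) (+ mono? a b L1) (+ mono? a b L2) (count L0 v) (count L1 v) (count L2 v))
    where
    step : ∀ p q s x y z → s + (p * x + q * y + s * z) ≡ p * x + q * y + s * (+ 1 + z)
    step = solve-∀

  8·m2after-closed : ∀ a (F : List Letter → ℤ) → F [] ≡ 0ℤ → (∀ b v → + 8 * pairsℤ a b v + F v ≡ F (b ∷ v)) →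
                     ∀ v → + (8 ℕ.* m2after a v) ≡ F v
  8·m2after-closed a F F[] F∷ []      = sym F[]
  8·m2after-closed a F F[] F∷ (b ∷ v) = begin
    + (8 ℕ.* m2after a (b ∷ v))                       ≡⟨ cong (λ t → + (8 ℕ.* t)) (m2after-∷ a b v) ⟩
    + (8 ℕ.* (pairs a b v ℕ.+ m2after a v))           ≡⟨ cong +_ (ℕ.*-distribˡ-+ 8 (pairs a b v) (m2after a v)) ⟩
    + (8 ℕ.* pairs a b v) + + (8 ℕ.* m2after a v)     ≡⟨ cong₂ _+_ (ℤ.pos-* 8 (pairs a b v)) (8·m2after-closed a F F[] F∷ v) ⟩
    + 8 * + pairs a b v + F v                         ≡⟨ cong (λ t → + 8 * t + F v) (pairs-counts a b v) ⟩
    + 8 * pairsℤ a b v + F v                          ≡⟨ F∷ b v ⟩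
    F (b ∷ v)                                         ∎
    where open ≡-Reasoning

  8·m2after₁ : ∀ v → + (8 ℕ.* m2after L1 v) ≡ + 2 * sq (balance v) + corr₁ (onesMask v)
  8·m2after₁ = 8·m2after-closed L1 F refl step
    where
    F : List Letter → ℤ
    F v = + 2 * sq (balance v) + corr₁ (onesMask v)
    step : ∀ b v → + 8 * pairsℤ L1 b v + F v ≡ F (b ∷ v)
    step L0 v = after₀ (count L0 v) (count L1 v) (count L2 v) _ (others-mask v)
      where
      after₀ : ∀ x y z D {O} → O ≡ x + z →
        + 8 * (+ 1 * x + + 0 * y + + 0 * z) + (+ 2 * ((x - z) * (x - z)) + D)
        ≡ + 2 * ((+ 1 + x - z) * (+ 1 + x - z)) + (D + (+ 4 * O - + 2))
      after₀ x y z D refl = solve (x ∷ y ∷ z ∷ D ∷ [])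
    step L1 v = after₁ (count L0 v) (count L1 v) (count L2 v) _ (others-mask v) (ones-mask v)
      where
      after₁ : ∀ x y z D {O C} → O ≡ x + z → C ≡ y →
        + 8 * (+ 1 * x + + 1 * y + + 1 * z) + (+ 2 * ((x - z) * (x - z)) + D)
        ≡ + 2 * ((x - z) * (x - z)) + (D + + 8 * (O + C))
      after₁ x y z D refl refl = solve (x ∷ y ∷ z ∷ D ∷ [])
    step L2 v = after₂ (count L0 v) (count L1 v) (count L2 v) _ (others-mask v)
      where
      after₂ : ∀ x y z D {O} → O ≡ x + z →
        + 8 * (+ 0 * x + + 0 * y + + 1 * z) + (+ 2 * ((x - z) * (x - z)) + D)
        ≡ + 2 * ((x - (+ 1 + z)) * (x - (+ 1 + z))) + (D + (+ 4 * O - + 2))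
      after₂ x y z D refl = solve (x ∷ y ∷ z ∷ D ∷ [])

  8·m2after₀ : ∀ v → + (8 ℕ.* m2after L0 v)
               ≡ sq (balance v - + 1) + + 2 * walkSum (- balance v) v + weight v + corr₀ (onesMask v)
  8·m2after₀ = 8·m2after-closed L0 F refl step
    where
    F : List Letter → ℤ
    F v = sq (balance v - + 1) + + 2 * walkSum (- balance v) v + weight v + corr₀ (onesMask v)
    step : ∀ b v → + 8 * pairsℤ L0 b v + F v ≡ F (b ∷ v)
    step L0 v = after₀ (count L0 v) (count L1 v) (count L2 v) _ (walkSum (- balance v) v)
      (others-mask v) (ones-mask v) (weight-counts v) (walkSum-+′ (- balance v) (+ 1) v (restart₀ v))
      where
      after₀ : ∀ x y z D L {O C W L′} → O ≡ x + z → C ≡ y → W ≡ x + z + + 2 * y → L′ ≡ L + + 1 * W →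
        + 8 * (+ 1 * x + + 1 * y + + 1 * z) + ((x - z - + 1) * (x - z - + 1) + + 2 * L + W + D)
        ≡ (+ 1 + x - z - + 1) * (+ 1 + x - z - + 1) + + 2 * (+ 1 * (- (+ 1 + x - z) + + 2) + L′) + (+ 1 + W)
          + (D + (+ 6 * O + + 4 * C - + 2))
      after₀ x y z D L refl refl refl refl = solve (x ∷ y ∷ z ∷ D ∷ L ∷ [])
    step L1 v = after₁ (count L0 v) (count L1 v) (count L2 v) _ (walkSum (- balance v) v)
      (others-mask v) (ones-mask v) (weight-counts v)
      where
      after₁ : ∀ x y z D L {O C W} → O ≡ x + z → C ≡ y → W ≡ x + z + + 2 * y →
        + 8 * (+ 0 * x + + 1 * y + + 1 * z) + ((x - z - + 1) * (x - z - + 1) + + 2 * L + W + D)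
        ≡ (x - z - + 1) * (x - z - + 1) + + 2 * (+ 2 * (- (x - z)) + L) + (+ 2 + W)
          + (D + (+ 8 * C + + 4 * O - + 2))
      after₁ x y z D L refl refl refl = solve (x ∷ y ∷ z ∷ D ∷ L ∷ [])
    step L2 v = after₂ (count L0 v) (count L1 v) (count L2 v) _ (walkSum (- balance v) v)
      (others-mask v) (ones-mask v) (weight-counts v) (walkSum-+′ (- balance v) -1ℤ v (restart₂ v))
      where
      after₂ : ∀ x y z D L {O C W L′} → O ≡ x + z → C ≡ y → W ≡ x + z + + 2 * y → L′ ≡ L + -1ℤ * W →
        + 8 * (+ 0 * x + + 0 * y + + 1 * z) + ((x - z - + 1) * (x - z - + 1) + + 2 * L + W + D)
        ≡ (x - (+ 1 + z) - + 1) * (x - (+ 1 + z) - + 1) + + 2 * (+ 1 * (- (x - (+ 1 + z)) - + 2) + L′) + (+ 1 + W)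
          + (D + (+ 6 * O + + 4 * C - + 2))
      after₂ x y z D L refl refl refl refl = solve (x ∷ y ∷ z ∷ D ∷ L ∷ [])

  8·m2after₂ : ∀ v → + (8 ℕ.* m2after L2 v)
               ≡ sq (balance v + + 1) - + 2 * walkSum (- balance v) v + weight v + corr₀ (onesMask v)
  8·m2after₂ = 8·m2after-closed L2 F refl step
    where
    F : List Letter → ℤ
    F v = sq (balance v + + 1) - + 2 * walkSum (- balance v) v + weight v + corr₀ (onesMask v)
    step : ∀ b v → + 8 * pairsℤ L2 b v + F v ≡ F (b ∷ v)
    step L0 v = after₀ (count L0 v) (count L1 v) (count L2 v) _ (walkSum (- balance v) v)
      (others-mask v) (ones-mask v) (weight-counts v) (walkSum-+′ (- balance v) (+ 1) v (restart₀ v))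
      where
      after₀ : ∀ x y z D L {O C W L′} → O ≡ x + z → C ≡ y → W ≡ x + z + + 2 * y → L′ ≡ L + + 1 * W →
        + 8 * (+ 1 * x + + 0 * y + + 0 * z) + ((x - z + + 1) * (x - z + + 1) - + 2 * L + W + D)
        ≡ (+ 1 + x - z + + 1) * (+ 1 + x - z + + 1) - + 2 * (+ 1 * (- (+ 1 + x - z) + + 2) + L′) + (+ 1 + W)
          + (D + (+ 6 * O + + 4 * C - + 2))
      after₀ x y z D L refl refl refl refl = solve (x ∷ y ∷ z ∷ D ∷ L ∷ [])
    step L1 v = after₁ (count L0 v) (count L1 v) (count L2 v) _ (walkSum (- balance v) v)
      (others-mask v) (ones-mask v) (weight-counts v)
      where
      after₁ : ∀ x y z D L {O C W} → O ≡ x + z → C ≡ y → W ≡ x + z + + 2 * y →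
        + 8 * (+ 1 * x + + 1 * y + + 0 * z) + ((x - z + + 1) * (x - z + + 1) - + 2 * L + W + D)
        ≡ (x - z + + 1) * (x - z + + 1) - + 2 * (+ 2 * (- (x - z)) + L) + (+ 2 + W)
          + (D + (+ 8 * C + + 4 * O - + 2))
      after₁ x y z D L refl refl refl = solve (x ∷ y ∷ z ∷ D ∷ L ∷ [])
    step L2 v = after₂ (count L0 v) (count L1 v) (count L2 v) _ (walkSum (- balance v) v)
      (others-mask v) (ones-mask v) (weight-counts v) (walkSum-+′ (- balance v) -1ℤ v (restart₂ v))
      where
      after₂ : ∀ x y z D L {O C W L′} → O ≡ x + z → C ≡ y → W ≡ x + z + + 2 * y → L′ ≡ L + -1ℤ * W →
        + 8 * (+ 1 * x + + 1 * y + + 1 * z) + ((x - z + + 1) * (x - z + + 1) - + 2 * L + W + D)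
        ≡ (x - (+ 1 + z) + + 1) * (x - (+ 1 + z) + + 1) - + 2 * (+ 1 * (- (x - (+ 1 + z)) - + 2) + L′) + (+ 1 + W)
          + (D + (+ 6 * O + + 4 * C - + 2))
      after₂ x y z D L refl refl refl refl = solve (x ∷ y ∷ z ∷ D ∷ L ∷ [])

  8·m3 : ∀ w → + (8 ℕ.* m3 w) ≡ Φ w + corr (onesMask w)
  8·m3 []      = refl
  8·m3 (b ∷ v) = begin
    + (8 ℕ.* (m2after b v ℕ.+ m3 v))                      ≡⟨ cong +_ (ℕ.*-distribˡ-+ 8 (m2after b v) (m3 v)) ⟩
    + (8 ℕ.* m2after b v) + + (8 ℕ.* m3 v)                ≡⟨ cong (λ t → + (8 ℕ.* m2after b v) + t) (8·m3 v) ⟩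
    + (8 ℕ.* m2after b v) + (Φ v + corr (onesMask v))     ≡⟨ step b ⟩
    Φ (b ∷ v) + corr (onesMask (b ∷ v))                   ∎
    where
    open ≡-Reasoning
    P K L : ℤ
    P = Φ v
    K = corr (onesMask v)
    L = walkSum (- balance v) v
    step : ∀ b → + (8 ℕ.* m2after b v) + (P + K) ≡ Φ (b ∷ v) + corr (onesMask (b ∷ v))
    step L0 = trans (cong (λ t → t + (P + K)) (8·m2after₀ v))
      (after₀ (count L0 v) (count L2 v) L (weight v) _ P K (walkSq-+′ (- balance v) (+ 1) v (restart₀ v)))
      where
      after₀ : ∀ x z L W D P K {P′} → P′ ≡ P + + 2 * + 1 * L + + 1 * + 1 * W →
        ((x - z - + 1) * (x - z - + 1) + + 2 * L + W + D) + (P + K)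
        ≡ + 1 * ((- (+ 1 + x - z) + + 2) * (- (+ 1 + x - z) + + 2)) + P′ + (K + D)
      after₀ x z L W D P K refl = solve (x ∷ z ∷ L ∷ W ∷ D ∷ P ∷ K ∷ [])
    step L1 = trans (cong (λ t → t + (P + K)) (8·m2after₁ v)) (after₁ (count L0 v) (count L2 v) _ P K)
      where
      after₁ : ∀ x z D P K →
        (+ 2 * ((x - z) * (x - z)) + D) + (P + K) ≡ + 2 * ((- (x - z)) * (- (x - z))) + P + (K + D)
      after₁ = solve-∀
    step L2 = trans (cong (λ t → t + (P + K)) (8·m2after₂ v))
      (after₂ (count L0 v) (count L2 v) L (weight v) _ P K (walkSq-+′ (- balance v) -1ℤ v (restart₂ v)))
      where
      after₂ : ∀ x z L W D P K {P′} → P′ ≡ P + + 2 * -1ℤ * L + -1ℤ * -1ℤ * W →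
        ((x - z + + 1) * (x - z + + 1) - + 2 * L + W + D) + (P + K)
        ≡ + 1 * ((- (x - (+ 1 + z)) - + 2) * (- (x - (+ 1 + z)) - + 2)) + P′ + (K + D)
      after₂ x z L W D P K refl = solve (x ∷ z ∷ L ∷ W ∷ D ∷ P ∷ K ∷ [])

  -- Walks through odd integers

  Oddℤ : ℤ → Set
  Oddℤ r = Σ ℤ λ t → r ≡ + 1 + + 2 * t

  odd-next : ∀ a {r} → Oddℤ r → Oddℤ (next a r)
  odd-next L0 (t , refl) = t + + 1 , up t
    where
    up : ∀ t → + 1 + + 2 * t + + 2 ≡ + 1 + + 2 * (t + + 1)
    up = solve-∀
  odd-next L1 o          = o
  odd-next L2 (t , refl) = t - + 1 , down t
    where
    down : ∀ t → + 1 + + 2 * t - + 2 ≡ + 1 + + 2 * (t - + 1)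
    down = solve-∀

  odd-neg : ∀ {r} → Oddℤ r → Oddℤ (- r)
  odd-neg (t , refl) = - t - + 1 , flip t
    where
    flip : ∀ t → - (+ 1 + + 2 * t) ≡ + 1 + + 2 * (- t - + 1)
    flip = solve-∀

  balance-odd : ∀ k y v → length v ≡ suc (k ℕ.+ k) → occ L1 v ≡ y ℕ.+ y → Oddℤ (balance v)
  balance-odd k y v len ones = + k - + y - count L2 v , (begin
    count L0 v - count L2 v                                      ≡⟨ split (count L0 v) (count L1 v) (count L2 v) ⟩
    (count L0 v + count L1 v + count L2 v) - count L1 v - + 2 * count L2 v
      ≡⟨ cong₂ (λ ℓ o → ℓ - o - + 2 * count L2 v) (trans (sym (length-counts v)) (cong +_ len)) (cong +_ ones) ⟩
    + suc (k ℕ.+ k) - + (y ℕ.+ y) - + 2 * count L2 v             ≡⟨ halve (+ k) (+ y) (count L2 v) ⟩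
    + 1 + + 2 * (+ k - + y - count L2 v)                         ∎)
    where
    open ≡-Reasoning
    split : ∀ x y z → x - z ≡ (x + y + z) - y - + 2 * z
    split = solve-∀
    halve : ∀ k y z → + 1 + (k + k) - (y + y) - + 2 * z ≡ + 1 + + 2 * (k - y - z)
    halve = solve-∀

  pronic : ∀ t → Σ ℕ λ p → t * t + t ≡ + p
  pronic (+ k)    = k ℕ.* k ℕ.+ k , cong (_+ + k) (sym (ℤ.pos-* k k))
  pronic -[1+ k ] = k ℕ.* k ℕ.+ k , trans (mirror (+ k)) (cong (_+ + k) (sym (ℤ.pos-* k k)))
    where
    mirror : ∀ x → (- (+ 1 + x)) * (- (+ 1 + x)) + (- (+ 1 + x)) ≡ x * x + x
    mirror = solve-∀

  odd-sq : ∀ {r} → Oddℤ r → + 1 ≤ sq r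
  odd-sq (t , refl) with pronic t
  ... | p , t²+t≡p = begin
    + 1                                  ≤⟨ ℤ.i≤i+j (+ 1) (+ (4 ℕ.* p)) ⟩
    + 1 + + (4 ℕ.* p)                    ≡⟨ cong (λ u → + 1 + u) (ℤ.pos-* 4 p) ⟩
    + 1 + + 4 * + p                      ≡⟨ cong (λ u → + 1 + + 4 * u) t²+t≡p ⟨
    + 1 + + 4 * (t * t + t)              ≡⟨ square t ⟩
    (+ 1 + + 2 * t) * (+ 1 + + 2 * t)    ∎
    where
    open ≤-Reasoning
    square : ∀ t → + 1 + + 4 * (t * t + t) ≡ (+ 1 + + 2 * t) * (+ 1 + + 2 * t)
    square = solve-∀

  odd≢0 : ∀ {r} → Oddℤ r → r ≡ 0ℤ → ⊥
  odd≢0 o refl with odd-sq o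
  ... | +≤+ ()

  μ≤μ*sq : ∀ a {r} → Oddℤ r → μ a ≤ μ a * sq (next a r)
  μ≤μ*sq L0 o = ℤ.*-monoˡ-≤-nonNeg (+ 1) (odd-sq (odd-next L0 o))
  μ≤μ*sq L1 o = ℤ.*-monoˡ-≤-nonNeg (+ 2) (odd-sq (odd-next L1 o))
  μ≤μ*sq L2 o = ℤ.*-monoˡ-≤-nonNeg (+ 1) (odd-sq (odd-next L2 o))

  μ-outer : ∀ {a} → Outer a → μ a ≡ + 1
  μ-outer outer₀ = refl
  μ-outer outer₂ = refl

  weight≤walkSq : ∀ {r} → Oddℤ r → ∀ v → weight v ≤ walkSq r v
  weight≤walkSq o []      = ℤ.≤-refl
  weight≤walkSq o (a ∷ v) = ℤ.+-mono-≤ (μ≤μ*sq a o) (weight≤walkSq (odd-next a o) v)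

  prepend : ∀ a {r} → Oddℤ r → ∀ {W e P} c → W + e ≤ P + c → (μ a + W) + e ≤ (μ a * sq (next a r) + P) + c
  prepend a {r} o {W} {e} {P} c le = begin
    (μ a + W) + e                      ≡⟨ ℤ.+-assoc (μ a) W e ⟩
    μ a + (W + e)                      ≤⟨ ℤ.+-monoʳ-≤ (μ a) le ⟩
    μ a + (P + c)                      ≤⟨ ℤ.+-monoˡ-≤ (P + c) (μ≤μ*sq a o) ⟩
    μ a * sq (next a r) + (P + c)      ≡⟨ ℤ.+-assoc (μ a * sq (next a r)) P c ⟨
    (μ a * sq (next a r) + P) + c      ∎
    where open ≤-Reasoning

  prepend-sq : ∀ a {r} → Oddℤ r → ∀ {W e P} → W + e ≤ P + sq (next a r) →
               (μ a + W) + e ≤ (μ a * sq (next a r) + P) + sq r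
  prepend-sq a {r} o {W} {e} {P} le = begin
    (μ a + W) + e                      ≡⟨ ℤ.+-assoc (μ a) W e ⟩
    μ a + (W + e)                      ≤⟨ ℤ.+-monoʳ-≤ (μ a) le ⟩
    μ a + (P + s)                      ≡⟨ x∙yz≈xz∙y (μ a) P s ⟩
    (μ a + s) + P                      ≤⟨ ℤ.+-monoˡ-≤ P (step a) ⟩
    (μ a * s + sq r) + P               ≡⟨ xy∙z≈xz∙y (μ a * s) (sq r) P ⟩
    (μ a * s + P) + sq r               ∎
    where
    open ≤-Reasoning
    s : ℤ
    s = sq (next a r)
    outer-step : ∀ s → + 1 + s ≤ + 1 * s + sq r
    outer-step s = begin
      + 1 + s       ≡⟨ ℤ.+-comm (+ 1) s ⟩
      s + + 1       ≤⟨ ℤ.+-monoʳ-≤ s (odd-sq o) ⟩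
      s + sq r      ≡⟨ cong (_+ sq r) (ℤ.*-identityˡ s) ⟨
      + 1 * s + sq r ∎
    step : ∀ a → μ a + sq (next a r) ≤ μ a * sq (next a r) + sq r
    step L0 = outer-step (sq (next L0 r))
    step L1 = ℤ.+-monoˡ-≤ (sq r) (μ≤μ*sq L1 o)
    step L2 = outer-step (sq (next L2 r))

  end-bound : ∀ {r} → Oddℤ r → ∀ v → weight v + sq (walkEnd r v) ≤ walkSq r v + sq r
  end-bound o []      = ℤ.≤-refl
  end-bound o (a ∷ v) = prepend-sq a o (end-bound (odd-next a o) v)

  end-bound-outer : ∀ {r} → Oddℤ r → ∀ {v} → Any Outer v → weight v + sq (walkEnd r v) ≤ walkSq r v + + 1
  end-bound-outer {r} o {a ∷ v} (here oa) = begin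
    (μ a + weight v) + e                     ≡⟨ ℤ.+-assoc (μ a) (weight v) e ⟩
    μ a + (weight v + e)                     ≤⟨ ℤ.+-monoʳ-≤ (μ a) (end-bound (odd-next a o) v) ⟩
    μ a + (walkSq (next a r) v + s)          ≡⟨ shuffle (walkSq (next a r) v) s (μ-outer oa) ⟩
    (μ a * s + walkSq (next a r) v) + + 1    ∎
    where
    open ≤-Reasoning
    e s : ℤ
    e = sq (walkEnd (next a r) v)
    s = sq (next a r)
    shuffle : ∀ P s {m} → m ≡ + 1 → m + (P + s) ≡ (m * s + P) + + 1
    shuffle P s refl = solve (P ∷ s ∷ [])
  end-bound-outer o {b ∷ v} (there p) = prepend b o (+ 1) (end-bound-outer (odd-next b o) p)

  leads-bound : ∀ {a r} → Oddℤ r → Outer a → ∀ {v} → LeadsWith a v → weight v + sq (next a r) ≤ walkSq r v + + 1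
  leads-bound {a} {r} o oa {L1 ∷ v} (skip p) = prepend L1 o {weight v} {sq (next a r)} (+ 1) (leads-bound o oa p)
  leads-bound {a} {r} o oa {a ∷ v} hit = begin
    (μ a + weight v) + s                      ≡⟨ shuffle (weight v) s (μ-outer oa) ⟩
    weight v + (μ a * s)  + + 1               ≤⟨ ℤ.+-monoˡ-≤ (+ 1) (ℤ.+-monoˡ-≤ (μ a * s) (weight≤walkSq (odd-next a o) v)) ⟩
    walkSq (next a r) v + (μ a * s) + + 1     ≡⟨ cong (_+ + 1) (ℤ.+-comm (walkSq (next a r) v) (μ a * s)) ⟩
    (μ a * s + walkSq (next a r) v) + + 1     ∎
    where
    open ≤-Reasoning
    s : ℤ
    s = sq (next a r)
    shuffle : ∀ W s {m} → m ≡ + 1 → (m + W) + s ≡ W + (m * s) + + 1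
    shuffle W s refl = solve (W ∷ s ∷ [])

  three-squares : ∀ {a r} → Outer a → Oddℤ r → + 11 ≤ sq r + sq (next a r) + sq (next a (next a r))
  three-squares {a} {r} oa o = begin
    + 11                                            ≤⟨ ℤ.+-monoˡ-≤ (+ 8) (ℤ.*-monoˡ-≤-nonNeg (+ 3) (odd-sq (odd-next a o))) ⟩
    + 3 * sq (next a r) + + 8                       ≡⟨ spread oa ⟩
    sq r + sq (next a r) + sq (next a (next a r))   ∎
    where
    open ≤-Reasoning
    spread₀ : ∀ r → + 3 * ((r + + 2) * (r + + 2)) + + 8 ≡ r * r + (r + + 2) * (r + + 2) + (r + + 2 + + 2) * (r + + 2 + + 2)
    spread₀ = solve-∀
    spread₂ : ∀ r → + 3 * ((r - + 2) * (r - + 2)) + + 8 ≡ r * r + (r - + 2) * (r - + 2) + (r - + 2 - + 2) * (r - + 2 - + 2)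
    spread₂ = solve-∀
    spread : ∀ {a} → Outer a → + 3 * sq (next a r) + + 8 ≡ sq r + sq (next a r) + sq (next a (next a r))
    spread outer₀ = spread₀ r
    spread outer₂ = spread₂ r

  repeats-bound : ∀ {r} → Oddℤ r → ∀ {v} → Repeats v → weight v + + 9 ≤ walkSq r v + sq r
  repeats-bound {r} o {a ∷ v} (here oa p) = +-cancelʳ-≤ s₂ (begin
    (μ a + weight v) + + 9 + s₂       ≡⟨ shuffle₁ (μ a) (weight v) s₂ ⟩
    (weight v + s₂) + (μ a + + 9)     ≤⟨ ℤ.+-monoˡ-≤ (μ a + + 9) (leads-bound (odd-next a o) oa p) ⟩
    (P + + 1) + (μ a + + 9)           ≡⟨ shuffle₂ P (μ-outer oa) ⟩
    P + + 11                          ≤⟨ ℤ.+-monoʳ-≤ P (three-squares oa o) ⟩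
    P + (sq r + s₁ + s₂)              ≡⟨ shuffle₃ P (sq r) s₁ s₂ (μ-outer oa) ⟩
    (μ a * s₁ + P) + sq r + s₂        ∎)
    where
    open ≤-Reasoning
    P s₁ s₂ : ℤ
    P  = walkSq (next a r) v
    s₁ = sq (next a r)
    s₂ = sq (next a (next a r))
    shuffle₁ : ∀ m W s → (m + W) + + 9 + s ≡ (W + s) + (m + + 9)
    shuffle₁ = solve-∀
    shuffle₂ : ∀ P {m} → m ≡ + 1 → (P + + 1) + (m + + 9) ≡ P + + 11
    shuffle₂ P refl = solve (P ∷ [])
    shuffle₃ : ∀ P s₀ s₁ s₂ {m} → m ≡ + 1 → P + (s₀ + s₁ + s₂) ≡ (m * s₁ + P) + s₀ + s₂
    shuffle₃ P s₀ s₁ s₂ refl = solve (P ∷ s₀ ∷ s₁ ∷ s₂ ∷ [])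
  repeats-bound {r} o {b ∷ v} (there p) = prepend-sq b o {weight v} {+ 9} (repeats-bound (odd-next b o) p)

  Φ-repeats : ∀ {v} → Oddℤ (balance v) → Repeats v → weight v < Φ v
  Φ-repeats {v} odd rep = ℤ.≰⇒> λ Φ≤W → eight≰0 (+-cancelʳ-≤ T (begin
    + 8 + T                   ≡⟨ shuffle W s ⟩
    (W + + 9) + (W + s)       ≤⟨ ℤ.+-mono-≤ (repeats-bound o rep) end ⟩
    (Φ v + s) + (Φ v + + 1)   ≤⟨ ℤ.+-mono-≤ (ℤ.+-monoˡ-≤ s Φ≤W) (ℤ.+-monoˡ-≤ (+ 1) Φ≤W) ⟩
    T                         ≡⟨ ℤ.+-identityˡ T ⟨
    0ℤ + T                    ∎))
    where
    open ≤-Reasoning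
    o : Oddℤ (- balance v)
    o = odd-neg odd
    W s T : ℤ
    W = weight v
    s = sq (- balance v)
    T = (W + s) + (W + + 1)
    end : W + s ≤ Φ v + + 1
    end = ℤ.≤-trans (ℤ.≤-reflexive (cong (λ t → W + t) (sym (sq-walkEnd v)))) (end-bound-outer o (repeats-outer rep))
    shuffle : ∀ W s → + 8 + ((W + s) + (W + + 1)) ≡ (W + + 9) + (W + s)
    shuffle = solve-∀
    eight≰0 : + 8 ≤ 0ℤ → ⊥
    eight≰0 (+≤+ ())

  -- The alternating word with the same letters 1

  start : Bool → ℤ
  start true  = -1ℤ
  start false = + 1

  -- from start b, the walk of alternate b v only visits ±1
  walkSq-alternate : ∀ b v → walkSq (start b) (alternate b v) ≡ weight (alternate b v)
  walkSq-alternate b     []       = refl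
  walkSq-alternate true  (L1 ∷ v) = cong (λ t → + 2 + t) (walkSq-alternate true v)
  walkSq-alternate false (L1 ∷ v) = cong (λ t → + 2 + t) (walkSq-alternate false v)
  walkSq-alternate true  (L0 ∷ v) = cong (λ t → + 1 + t) (walkSq-alternate false v)
  walkSq-alternate true  (L2 ∷ v) = cong (λ t → + 1 + t) (walkSq-alternate false v)
  walkSq-alternate false (L0 ∷ v) = cong (λ t → + 1 + t) (walkSq-alternate true v)
  walkSq-alternate false (L2 ∷ v) = cong (λ t → + 1 + t) (walkSq-alternate true v)

  weight-alternate : ∀ b v → weight (alternate b v) ≡ weight v
  weight-alternate b     []       = refl
  weight-alternate b     (L1 ∷ v) = cong (λ t → + 2 + t) (weight-alternate b v)
  weight-alternate true  (L0 ∷ v) = cong (λ t → + 1 + t) (weight-alternate false v)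
  weight-alternate true  (L2 ∷ v) = cong (λ t → + 1 + t) (weight-alternate false v)
  weight-alternate false (L0 ∷ v) = cong (λ t → + 1 + t) (weight-alternate true v)
  weight-alternate false (L2 ∷ v) = cong (λ t → + 1 + t) (weight-alternate true v)

  occ₁-alternate : ∀ b v → occ L1 (alternate b v) ≡ occ L1 v
  occ₁-alternate b v = ℤ.+-injective (begin
    count L1 (alternate b v)           ≡⟨ ones-mask (alternate b v) ⟨
    ones (onesMask (alternate b v))    ≡⟨ cong ones (onesMask-alternate b v) ⟩
    ones (onesMask v)                  ≡⟨ ones-mask v ⟩
    count L1 v                         ∎)
    where open ≡-Reasoning

  toggle : ∀ d {B B′} → B′ ≡ d + B → B ≡ 0ℤ ⊎ B ≡ - d → B′ ≡ 0ℤ ⊎ B′ ≡ d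
  toggle d e (inj₁ refl) = inj₂ (trans e (ℤ.+-identityʳ d))
  toggle d e (inj₂ refl) = inj₁ (trans e (ℤ.+-inverseʳ d))

  balance-alternate : ∀ b v → balance (alternate b v) ≡ 0ℤ ⊎ balance (alternate b v) ≡ - start b
  balance-alternate b     []       = inj₁ refl
  balance-alternate b     (L1 ∷ v) = balance-alternate b v
  balance-alternate true  (L0 ∷ v) = toggle (+ 1) (balance-L0 (alternate false v)) (balance-alternate false v)
  balance-alternate true  (L2 ∷ v) = toggle (+ 1) (balance-L0 (alternate false v)) (balance-alternate false v)
  balance-alternate false (L0 ∷ v) = toggle -1ℤ (balance-L2 (alternate true v)) (balance-alternate true v)
  balance-alternate false (L2 ∷ v) = toggle -1ℤ (balance-L2 (alternate true v)) (balance-alternate true v)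

  balance≡1⇒occ₂<occ₀ : ∀ v → balance v ≡ + 1 → occ L2 v ℕ.< occ L0 v
  balance≡1⇒occ₂<occ₀ v b≡1 = ℕ.≤-reflexive (sym (ℤ.+-injective (begin
    count L0 v                       ≡⟨ restore (count L0 v) (count L2 v) ⟩
    balance v + count L2 v           ≡⟨ cong (_+ count L2 v) b≡1 ⟩
    + 1 + count L2 v                 ∎)))
    where
    open ≡-Reasoning
    restore : ∀ x z → x ≡ (x - z) + z
    restore = solve-∀

  alternate-balance≡1 : ∀ {n} y w → Odd n → InSet n y w → balance (alternate true w) ≡ + 1
  alternate-balance≡1 y w (k , n≡) (len , ones , _) with balance-alternate true w
  ... | inj₁ b≡0 = ⊥-elim (odd≢0 (balance-odd k y (alternate true w) len′ ones′) b≡0)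
    where
    len′ : length (alternate true w) ≡ suc (k ℕ.+ k)
    len′ = trans (length-alternate true w) (trans len n≡)
    ones′ : occ L1 (alternate true w) ≡ y ℕ.+ y
    ones′ = trans (occ₁-alternate true w) ones
  ... | inj₂ b≡1 = b≡1

  InSet-alternate : ∀ {n} y w → Odd n → InSet n y w → InSet n y (alternate true w)
  InSet-alternate y w odd w∈@(len , ones , _) =
    trans (length-alternate true w) len ,
    trans (occ₁-alternate true w) ones ,
    balance≡1⇒occ₂<occ₀ (alternate true w) (alternate-balance≡1 y w odd w∈)

  alternate-improves : ∀ {n} y w → Odd n → InSet n y w → Repeats w → m3 (alternate true w) ℕ.< m3 w
  alternate-improves y w odd@(k , n≡) w∈@(len , ones , _) rep = ℕ.*-cancelˡ-< 8 _ _ (ℤ.drop‿+<+ (begin-strict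
    + (8 ℕ.* m3 w′)                 ≡⟨ 8·m3 w′ ⟩
    Φ w′ + corr (onesMask w′)       ≡⟨ cong₂ _+_ Φw′≡weight (cong corr (onesMask-alternate true w)) ⟩
    weight w + corr (onesMask w)    <⟨ ℤ.+-monoˡ-< (corr (onesMask w)) (Φ-repeats (balance-odd k y w (trans len n≡) ones) rep) ⟩
    Φ w + corr (onesMask w)         ≡⟨ 8·m3 w ⟨
    + (8 ℕ.* m3 w)                  ∎))
    where
    open ≤-Reasoning
    w′ : List Letter
    w′ = alternate true w
    Φw′≡weight : Φ w′ ≡ weight w
    Φw′≡weight = begin-equality
      walkSq (- balance w′) w′   ≡⟨ cong (λ B → walkSq (- B) w′) (alternate-balance≡1 y w odd w∈) ⟩
      walkSq -1ℤ w′              ≡⟨ walkSq-alternate true w ⟩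
      weight w′                  ≡⟨ weight-alternate true w ⟩
      weight w                   ∎

open Potential using (InSet-alternate; alternate-improves)
open import Data.Nat using (_+_; _≤_; _<_)
open import Data.Nat.Properties using (<⇒≱)

-- The hypothesis y + y < n only ensures that the set is non-empty, which the minimiser w already shows.
lemma2p1 : (y n : ℕ) → y + y < n → Odd n →
    (w : List Letter) → InSet n y w →
    ((w' : List Letter) → InSet n y w' → m3 w ≤ m3 w') →
    Alternating (delete1 w)
lemma2p1 y n _ odd w w∈ minimal with alternating⊎repeats w
... | inj₁ alternating = alternating
... | inj₂ repeats     =
  ⊥-elim (<⇒≱ (alternate-improves y w odd w∈ repeats) (minimal (alternate true w) (InSet-alternate y w odd w∈)))
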